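{- For every digraph $D$ and every integer $k$ with $2\le k\le |V(D)|$, we have $\kappa_k(D)\le\delta^+(D)$ and $\kappa_k(D)\le\delta^-(D)$.
   Context: Digraphs are finite, without loops or parallel arcs. $\delta^+(D)$ and $\delta^-(D)$ denote the minimum out-degree and minimum in-degree of $D$. A digraph is strong if for every ordered pair of vertices there is a directed path from the first to the second; a one-vertex digraph is strong. For $S\subseteq V(D)$, strong subgraphs $D_1,\dots,D_p$ of $D$ containing $S$ are $S$-internally disjoint if $V(D_i)\cap V(D_j)=S$ and $A(D_i)\cap A(D_j)=\emptyset$ for all $i<j$; $\kappa_S(D)$ is the maximum number of such subgraphs, and $\kappa_k(D)=\min\{\kappa_S(D): S\subseteq V(D), |S|=k\}$. -}

module Defs where

open import Data.Nat using (ℕ; zero; suc; _+_; _≤_; _⊓_)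
open import Data.Bool using (Bool; true; false)
open import Data.Fin using (Fin)
open import Data.Fin.Subset using (Subset; _∈_; ∣_∣)
open import Data.List using (List; map; allFin)
open import Data.Nat.ListAction using (sum)
open import Data.Product using (Σ; _×_; ∃-syntax)
open import Relation.Nullary using (¬_)
open import Relation.Binary.PropositionalEquality using (_≡_; _≢_)
open import Relation.Binary.Construct.Closure.ReflexiveTransitive using (Star)

-- A digraph on vertex set Fin n: an arc relation given as a Bool-valued
-- adjacency function, without loops (parallel arcs impossible by construction).
record Digraph (n : ℕ) : Set where
  field
    arc   : Fin n → Fin n → Bool
    loopless : ∀ v → arc v v ≡ false
open Digraph public

bit : Bool → ℕ
bit true  = 1
bit false = 0

outdeg : ∀ {n} → Digraph n → Fin n → ℕ
outdeg {n} D v = sum (map (λ w → bit (arc D v w)) (allFin n))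

indeg : ∀ {n} → Digraph n → Fin n → ℕ
indeg {n} D v = sum (map (λ w → bit (arc D w v)) (allFin n))

minFin : ∀ {m} → (Fin (suc m) → ℕ) → ℕ
minFin {zero}  f = f Fin.zero
minFin {suc m} f = f Fin.zero ⊓ minFin {m} (λ i → f (Fin.suc i))

δ⁺ : ∀ {m} → Digraph (suc m) → ℕ
δ⁺ D = minFin (outdeg D)

δ⁻ : ∀ {m} → Digraph (suc m) → ℕ
δ⁻ D = minFin (indeg D)

record Subgraph {n : ℕ} (D : Digraph n) : Set where
  field
    verts : Subset n
    arcs  : Fin n → Fin n → Bool
    arcs⊆ : ∀ u v → arcs u v ≡ true → arc D u v ≡ true
    tail∈ : ∀ u v → arcs u v ≡ true → u ∈ verts
    head∈ : ∀ u v → arcs u v ≡ true → v ∈ verts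
open Subgraph public

Arc : ∀ {n} {D : Digraph n} → Subgraph D → Fin n → Fin n → Set
Arc H u v = arcs H u v ≡ true

-- strong: every ordered pair of its vertices is joined by a directed path
-- (a walk using arcs of H, which stays inside verts H)
Strong : ∀ {n} {D : Digraph n} → Subgraph D → Set
Strong {n} H = ∀ (u v : Fin n) → u ∈ verts H → v ∈ verts H → Star (Arc H) u v

InternallyDisjointFamily : ∀ {n} (D : Digraph n) (S : Subset n) (p : ℕ) → Set
InternallyDisjointFamily {n} D S p =
  Σ (Fin p → Subgraph D) λ H →
      (∀ i → Strong (H i))
    × (∀ i (v : Fin n) → v ∈ S → v ∈ verts (H i))
    × (∀ i j → i ≢ j → ∀ (v : Fin n) → v ∈ verts (H i) → v ∈ verts (H j) → v ∈ S)
    × (∀ i j → i ≢ j → ∀ (u v : Fin n) → ¬ (Arc (H i) u v × Arc (H j) u v))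

κS≤ : ∀ {n} (D : Digraph n) (S : Subset n) (m : ℕ) → Set
κS≤ D S m = ∀ p → InternallyDisjointFamily D S p → p ≤ m

κk≤ : ∀ {n} (D : Digraph n) (k : ℕ) (m : ℕ) → Set
κk≤ {n} D k m = ∃[ S ] (∣ S ∣ ≡ k × κS≤ D S m)

module Submission where

-- Let v be a vertex of minimum out-degree and choose a
-- k-set S containing v and some other vertex u.  In any family H₁ … H_p of
-- S-internally disjoint strong subgraphs, each Hᵢ contains a v→u path, whose
-- first arc v→wᵢ is an out-arc of v in D.  The subgraphs are arc-disjoint,
-- so the heads wᵢ are pairwise distinct out-neighbours of v, and p ≤ d⁺(v).
--
-- The in-degree bound is obtained by
-- applying the out-degree bound to the converse digraph, whose out-degrees
-- are the in-degrees of D and which inherits every internally disjoint family.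

open import Defs
open import Data.Nat using (ℕ; zero; suc; _≤_; _+_; z≤n; s≤s; _≤?_)
open import Data.Nat.Properties
  using (≤-trans; ≤-reflexive; ≤-antisym; ⊓-sel; <⇒≤; <⇒≱; ≰⇒>)
open import Data.Bool using (Bool; true; false)
open import Data.Fin using (Fin) renaming (zero to fzero; suc to fsuc)
open import Data.Fin.Properties using (any?; suc-injective; 0≢1+n) renaming (_≟_ to _≟ᶠ_)
open import Data.Fin.Subset using (Subset; _∈_; ∣_∣; _⊆_; ⊤; ⁅_⁆; _-_; inside; outside)
open import Data.Fin.Subset.Properties
  using ( _∈?_; x∈p⇒∣p-x∣<∣p∣; x∈p∧x≢y⇒x∈p-y; p⊆q⇒∣p∣≤∣q∣; ∣⁅x⁆∣≡1; x∈⁅x⁆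
        ; ∣⊤∣≡n; ⊆⊤; in⊆in; s⊆s)
open import Data.Vec using ([]; _∷_)
import Data.Vec as Vec
open import Data.Vec.Properties using (lookup⇒[]=; lookup∘tabulate)
open import Data.List using (tabulate)
open import Data.List.Properties using (map-tabulate)
open import Data.Nat.ListAction using (sum)
open import Data.Product using (_×_; _,_; ∃; proj₁; proj₂)
open import Data.Sum using (inj₁; inj₂)
open import Function using (_∘_; id)
open import Function.Definitions using (Injective)
open import Relation.Nullary using (yes; no; contradiction; ¬?)
open import Relation.Nullary.Decidable using (_×-dec_; decidable-stable)
open import Relation.Binary.PropositionalEquality using (_≡_; _≢_; refl; sym; trans; cong; subst)
open import Relation.Binary.Construct.Closure.ReflexiveTransitive using (Star; ε; _◅_; reverse)

injection⇒≤∣∣ : ∀ {p n} (S : Subset n) (f : Fin p → Fin n) →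
  Injective _≡_ _≡_ f → (∀ i → f i ∈ S) → p ≤ ∣ S ∣
injection⇒≤∣∣ {zero}  S f f-inj f∈S = z≤n
injection⇒≤∣∣ {suc p} S f f-inj f∈S =
  ≤-trans (s≤s rest≤∣S-f₀∣) (x∈p⇒∣p-x∣<∣p∣ (f∈S fzero))
  where
  rest≤∣S-f₀∣ : p ≤ ∣ S - f fzero ∣
  rest≤∣S-f₀∣ = injection⇒≤∣∣ (S - f fzero) (f ∘ fsuc) (suc-injective ∘ f-inj)
    (λ i → x∈p∧x≢y⇒x∈p-y (f∈S (fsuc i)) (λ fᵢ≡f₀ → 0≢1+n (sym (f-inj fᵢ≡f₀))))

extend : ∀ {n} (S : Subset n) {k} → ∣ S ∣ ≤ k → k ≤ n → ∃ λ T → S ⊆ T × ∣ T ∣ ≡ k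
extend []            z≤n       z≤n       = [] , id , refl
extend (inside ∷ S)  (s≤s S≤k) (s≤s k≤n) with extend S S≤k k≤n
... | T , S⊆T , ∣T∣≡k = inside ∷ T , in⊆in S⊆T , cong suc ∣T∣≡k
extend {suc n} (outside ∷ S) {k} S≤k k≤1+n with k ≤? n
... | yes k≤n = let T , S⊆T , ∣T∣≡k = extend S S≤k k≤n in outside ∷ T , s⊆s S⊆T , ∣T∣≡k
... | no  k≰n = ⊤ , ⊆⊤ , trans (∣⊤∣≡n (suc n)) (≤-antisym (≰⇒> k≰n) k≤1+n)

-- A set with at least two elements has an element other than any given v;
-- otherwise it would be contained in ⁅ v ⁆.
otherMember : ∀ {n} (T : Subset n) (v : Fin n) → 2 ≤ ∣ T ∣ → ∃ λ u → u ∈ T × u ≢ v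
otherMember T v 2≤∣T∣ with any? (λ u → (u ∈? T) ×-dec ¬? (u ≟ᶠ v))
... | yes found = found
... | no  none  = contradiction ∣T∣≤1 (<⇒≱ 2≤∣T∣)
  where
  T⊆⁅v⁆ : T ⊆ ⁅ v ⁆
  T⊆⁅v⁆ {u} u∈T = subst (_∈ ⁅ v ⁆) (sym u≡v) (x∈⁅x⁆ v)
    where
    u≡v : u ≡ v
    u≡v = decidable-stable (u ≟ᶠ v) (λ u≢v → none (u , u∈T , u≢v))
  ∣T∣≤1 : ∣ T ∣ ≤ 1
  ∣T∣≤1 = ≤-trans (p⊆q⇒∣p∣≤∣q∣ T⊆⁅v⁆) (≤-reflexive (∣⁅x⁆∣≡1 v))

twoPointSubset : ∀ {n} (v : Fin n) {k} → 2 ≤ k → k ≤ n →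
  ∃ λ S → ∣ S ∣ ≡ k × v ∈ S × ∃ λ u → u ∈ S × u ≢ v
twoPointSubset v 2≤k k≤n with extend ⁅ v ⁆ (≤-trans (≤-reflexive (∣⁅x⁆∣≡1 v)) (<⇒≤ 2≤k)) k≤n
... | S , ⁅v⁆⊆S , ∣S∣≡k =
  S , ∣S∣≡k , ⁅v⁆⊆S (x∈⁅x⁆ v) , otherMember S v (subst (2 ≤_) (sym ∣S∣≡k) 2≤k)

minFin-attained : ∀ {m} (f : Fin (suc m) → ℕ) → ∃ λ v → minFin f ≡ f v
minFin-attained {zero}  f = fzero , refl
minFin-attained {suc m} f with ⊓-sel (f fzero) (minFin (f ∘ fsuc))
... | inj₁ min≡f₀ = fzero , min≡f₀
... | inj₂ min≡rest = let v , rest≡fv = minFin-attained (f ∘ fsuc) in fsuc v , trans min≡rest rest≡fv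

bitSum≡∣∣ : ∀ {n} (P : Fin n → Bool) → sum (tabulate (bit ∘ P)) ≡ ∣ Vec.tabulate P ∣
bitSum≡∣∣ {zero}  P = refl
bitSum≡∣∣ {suc n} P = trans (cong (bit (P fzero) +_) (bitSum≡∣∣ (P ∘ fsuc))) (∣∷∣ (P fzero))
  where
  ∣∷∣ : ∀ b → bit b + ∣ Vec.tabulate (P ∘ fsuc) ∣ ≡ ∣ b ∷ Vec.tabulate (P ∘ fsuc) ∣
  ∣∷∣ true  = refl
  ∣∷∣ false = refl

∈-tabulate : ∀ {n} (P : Fin n → Bool) {x} → P x ≡ true → x ∈ Vec.tabulate P
∈-tabulate P {x} Px = lookup⇒[]= x (Vec.tabulate P) (trans (lookup∘tabulate P x) Px)

outNeighbours : ∀ {n} → Digraph n → Fin n → Subset n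
outNeighbours D v = Vec.tabulate (arc D v)

outdeg≡∣outNeighbours∣ : ∀ {n} (D : Digraph n) v → outdeg D v ≡ ∣ outNeighbours D v ∣
outdeg≡∣outNeighbours∣ D v = trans (cong sum (map-tabulate id (bit ∘ arc D v))) (bitSum≡∣∣ (arc D v))

firstArc : ∀ {A : Set} {R : A → A → Set} {a b} → Star R a b → a ≢ b → ∃ λ w → R a w
firstArc ε       a≢a = contradiction refl a≢a
firstArc (r ◅ _) _   = _ , r

familySize≤outdeg : ∀ {n p} {D : Digraph n} {S : Subset n} →
  InternallyDisjointFamily D S p → ∀ {u v} → v ∈ S → u ∈ S → u ≢ v → p ≤ outdeg D v
familySize≤outdeg {n} {p} {D} (H , strong , S⊆H , _ , arcDisjoint) {u} {v} v∈S u∈S u≢v =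
  subst (_ ≤_) (sym (outdeg≡∣outNeighbours∣ D v))
    (injection⇒≤∣∣ (outNeighbours D v) head head-injective
      (λ i → ∈-tabulate (arc D v) (arcs⊆ (H i) v (head i) (proj₂ (firstOutArc i)))))
  where
  firstOutArc : ∀ i → ∃ λ w → Arc (H i) v w
  firstOutArc i = firstArc (strong i v u (S⊆H i v v∈S) (S⊆H i u u∈S)) (u≢v ∘ sym)
  head : Fin p → Fin n
  head = proj₁ ∘ firstOutArc
  head-injective : Injective _≡_ _≡_ head
  head-injective {i} {j} hᵢ≡hⱼ with i ≟ᶠ j
  ... | yes i≡j = i≡j
  ... | no  i≢j = contradiction
        (subst (Arc (H i) v) hᵢ≡hⱼ (proj₂ (firstOutArc i)) , proj₂ (firstOutArc j))
        (arcDisjoint i j i≢j v (head j))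

κk≤δ⁺ : ∀ {m} (D : Digraph (suc m)) {k} → 2 ≤ k → k ≤ suc m → κk≤ D k (δ⁺ D)
κk≤δ⁺ D 2≤k k≤n with minFin-attained (outdeg D)
... | v , δ⁺≡d⁺v with twoPointSubset v 2≤k k≤n
... | S , ∣S∣≡k , v∈S , u , u∈S , u≢v =
  S , ∣S∣≡k , λ p family → subst (p ≤_) (sym δ⁺≡d⁺v) (familySize≤outdeg family v∈S u∈S u≢v)

converse : ∀ {n} → Digraph n → Digraph n
converse D = record { arc = λ u w → arc D w u ; loopless = loopless D }

converseSubgraph : ∀ {n} {D : Digraph n} → Subgraph D → Subgraph (converse D)
converseSubgraph H = record
  { verts = verts H
  ; arcs  = λ u w → arcs H w u
  ; arcs⊆ = λ u w → arcs⊆ H w u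
  ; tail∈ = λ u w → head∈ H w u
  ; head∈ = λ u w → tail∈ H w u
  }

converseFamily : ∀ {n p} {D : Digraph n} {S : Subset n} →
  InternallyDisjointFamily D S p → InternallyDisjointFamily (converse D) S p
converseFamily (H , strong , S⊆H , vertexDisjoint , arcDisjoint) =
    converseSubgraph ∘ H
  , (λ i u w u∈ w∈ → reverse id (strong i w u w∈ u∈))
  , S⊆H
  , vertexDisjoint
  , (λ i j i≢j u w → arcDisjoint i j i≢j w u)

κk≤-fromConverse : ∀ {n} (D : Digraph n) {k m} → κk≤ (converse D) k m → κk≤ D k m
κk≤-fromConverse D (S , ∣S∣≡k , bound) = S , ∣S∣≡k , λ p family → bound p (converseFamily family)

-- The theorem; δ⁺ of the converse digraph is δ⁻ D by definition.
lemma3p2 : ∀ {m} (D : Digraph (suc m)) (k : ℕ) → 2 ≤ k → k ≤ suc m →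
    κk≤ D k (δ⁺ D) × κk≤ D k (δ⁻ D)
lemma3p2 D k 2≤k k≤n = κk≤δ⁺ D 2≤k k≤n , κk≤-fromConverse D (κk≤δ⁺ (converse D) 2≤k k≤n)
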